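{- Let $X=X_2$ with $|X|=1$. The three patterns $((1,3),2)$, $((1,2),3)$ and $(1,(2,3))$ are Wilf equivalent to each other; for each $n\ge3$, the number of trees with $n$ leaves avoiding any one of them is $(n-1)!$.
   Context: Binary trees are written as bracket expressions: a leaf is its label, and a tree whose root has left subtree $A$ and right subtree $B$ is written $(A,B)$. A tree with $l$ leaves is a planar binary rooted tree (single internal vertex label) with leaves labelled bijectively by $\{1,\dots,l\}$ so that, assigning to each internal vertex the minimum label of its descendant leaves, the left child of each internal vertex has a smaller assigned number than its right child. A subtree of $T$ is a subtree $S$ rooted at an internal vertex of $T$ such that for every internal vertex of $S$ both its children in $T$ are in $S$; its leaves carry the assigned integers and relabelling them order-preservingly by $1,\dots,l$ gives the standardisation $\mathrm{st}(S)$; $T$ avoids $P$ if $P\neq\mathrm{st}(S)$ for every subtree $S$. Patterns (or pattern sets) are Wilf equivalent if for every $l$ the numbers of trees with $l$ leaves avoiding them coincide. -}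

module Defs where

open import Data.Nat using (ℕ; zero; suc; _<ᵇ_; _≡ᵇ_; _⊓_)
open import Data.Bool using (Bool; true; false; _∧_; not; T)
open import Data.List using (List; []; _∷_; _++_; length; map; concatMap; upTo; filter)
open import Data.Bool.ListAction using (any; all)
open import Data.Product using (Σ)

-- Planar binary rooted trees (one operation label), leaves carrying natural-number labels.
data Tree : Set where
  leaf : ℕ → Tree
  node : Tree → Tree → Tree

labels : Tree → List ℕ
labels (leaf n)   = n ∷ []
labels (node a b) = labels a ++ labels b

minLab : Tree → ℕ
minLab (leaf n)   = n
minLab (node a b) = minLab a ⊓ minLab b

ordered : Tree → Bool
ordered (leaf _)   = true
ordered (node a b) = (minLab a <ᵇ minLab b) ∧ ordered a ∧ ordered b

elem : ℕ → List ℕ → Bool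
elem x xs = any (λ y → x ≡ᵇ y) xs

bijLabelled : ℕ → Tree → Bool
bijLabelled l t = (length (labels t) ≡ᵇ l) ∧ all (λ i → elem (suc i) (labels t)) (upTo l)

isTree : ℕ → Tree → Bool
isTree l t = bijLabelled l t ∧ ordered t

-- all S rooted at the root of t with: every internal vertex of S has both children in S;
-- leaves of S carry the assigned integer (min label below) of the corresponding vertex of t
cuts : Tree → List Tree
cuts (leaf n)   = leaf n ∷ []
cuts (node a b) = leaf (minLab (node a b)) ∷ concatMap (λ x → map (node x) (cuts b)) (cuts a)

subtrees : Tree → List Tree
subtrees (leaf _)   = []
subtrees (node a b) = cuts (node a b) ++ subtrees a ++ subtrees b

rank : List ℕ → ℕ → ℕ
rank xs x = suc (length (filter (λ y → y Data.Nat.<? x) xs))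

relabel : List ℕ → Tree → Tree
relabel xs (leaf n)   = leaf (rank xs n)
relabel xs (node a b) = node (relabel xs a) (relabel xs b)

st : Tree → Tree
st s = relabel (labels s) s

_==_ : Tree → Tree → Bool
leaf m     == leaf n     = m ≡ᵇ n
node a b   == node c d   = (a == c) ∧ (b == d)
_          == _          = false

avoids : Tree → Tree → Bool
avoids P t = not (any (λ s → st s == P) (subtrees t))

Avoiders : Tree → ℕ → Set
Avoiders P l = Σ Tree (λ t → T (isTree l t ∧ avoids P t))

p132 p123 p1-23 : Tree
p132  = node (node (leaf 1) (leaf 3)) (leaf 2)
p123  = node (node (leaf 1) (leaf 2)) (leaf 3)
p1-23 = node (leaf 1) (node (leaf 2) (leaf 3))

-- In an ordered tree the left child of every vertex carries its minimum, so whether one of the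
-- three patterns occurs rooted at a vertex depends only on minima of subtrees: ((1,2),3) occurs
-- at ((A₁,A₂),B) iff min A₂ < min B, ((1,3),2) iff min B < min A₂, and (1,(2,3)) at (A,B) iff B
-- is not a leaf. In a tree with l leaves the largest label l sits on a leaf that is a right
-- child, and deleting that leaf maps the avoiders with l leaves bijectively onto the pairs of an
-- avoider with l − 1 leaves and one of l − 1 places where the leaf l may be grafted back as a
-- right sibling: beside any leaf for ((1,2),3), beside the largest subtree starting at any given
-- leaf for ((1,3),2), and beside any vertex of the left spine for (1,(2,3)). So the avoiders
-- with l leaves correspond to Fin (l − 1) × (avoiders with l − 1 leaves).

module Submission where

open import Data.Bool using (Bool; true; false; _∧_; _∨_; not; T; if_then_else_)
open import Data.Bool.ListAction using (any; all)
open import Data.Bool.Properties using (∧-zeroʳ; ∨-zeroʳ; ∨-identityʳ; ∨-assoc; T-irrelevant; T-≡)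
open import Data.Empty using (⊥-elim)
open import Data.Fin using (Fin; zero; toℕ; fromℕ<)
open import Data.Fin.Properties using (toℕ<n; toℕ-fromℕ<; fromℕ<-toℕ; fromℕ<-cong; *↔×)
open import Data.List using (List; []; _∷_; _++_; length; map; concatMap; applyUpTo)
open import Data.List.Properties using (length-++)
open import Data.Nat using (ℕ; zero; suc; _+_; _∸_; _!; _<ᵇ_; _≡ᵇ_; _⊓_; _<_; _≤_; z≤n; s≤s; s≤s⁻¹)
open import Data.Nat.Properties
open import Data.Product using (_×_; _,_; proj₁; proj₂; ∃)
open import Data.Product.Function.NonDependent.Propositional using (_×-↔_)
open import Data.Sum using (inj₁; inj₂)
open import Function.Base using (_∘_)
open import Function.Bundles using (_↔_; mk↔ₛ′; Equivalence)
open import Function.Properties.Inverse using (↔-refl; ↔-sym; ↔-trans)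
open import Relation.Binary.Definitions using (tri<; tri≈; tri>)
open import Relation.Binary.PropositionalEquality
open import Relation.Nullary using (¬_; yes; no; contradiction)

open import Defs

true≢false : true ≢ false
true≢false ()

∧-true⁻ : ∀ {x y} → x ∧ y ≡ true → x ≡ true × y ≡ true
∧-true⁻ {true} {true} _ = refl , refl

∨-false⁻ : ∀ {x y} → x ∨ y ≡ false → x ≡ false × y ≡ false
∨-false⁻ {false} {false} _ = refl , refl

∨-∨-swap : ∀ x y z → (x ∨ y) ∨ z ≡ (x ∨ z) ∨ y
∨-∨-swap true y z = refl
∨-∨-swap false true true = refl
∨-∨-swap false true false = refl
∨-∨-swap false false z = sym (∨-identityʳ z)

not-true⁻ : ∀ {x} → not x ≡ true → x ≡ false
not-true⁻ {false} _ = refl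

<ᵇ-true : ∀ {m n} → m < n → (m <ᵇ n) ≡ true
<ᵇ-true m<n = Equivalence.to T-≡ (<⇒<ᵇ m<n)

<ᵇ-true⁻ : ∀ {m n} → (m <ᵇ n) ≡ true → m < n
<ᵇ-true⁻ {m} {n} eq = <ᵇ⇒< m n (Equivalence.from T-≡ eq)

<ᵇ-false : ∀ {m n} → n ≤ m → (m <ᵇ n) ≡ false
<ᵇ-false {m} {n} n≤m with m <ᵇ n in eq
... | false = refl
... | true = contradiction (<ᵇ-true⁻ eq) (≤⇒≯ n≤m)

<ᵇ-false⁻ : ∀ {m n} → (m <ᵇ n) ≡ false → n ≤ m
<ᵇ-false⁻ {m} {n} m≮n = ≮⇒≥ (λ m<n → true≢false (trans (sym (<ᵇ-true m<n)) m≮n))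

≡ᵇ-refl : ∀ n → (n ≡ᵇ n) ≡ true
≡ᵇ-refl n = Equivalence.to T-≡ (≡⇒≡ᵇ n n refl)

≡ᵇ-true⁻ : ∀ {m n} → (m ≡ᵇ n) ≡ true → m ≡ n
≡ᵇ-true⁻ {m} {n} eq = ≡ᵇ⇒≡ m n (Equivalence.from T-≡ eq)

≡ᵇ-false : ∀ {m n} → m ≢ n → (m ≡ᵇ n) ≡ false
≡ᵇ-false {m} {n} m≢n with m ≡ᵇ n in eq
... | false = refl
... | true = ⊥-elim (m≢n (≡ᵇ-true⁻ eq))

any-++ : ∀ {A : Set} (f : A → Bool) xs ys → any f (xs ++ ys) ≡ any f xs ∨ any f ys
any-++ f [] ys = refl
any-++ f (x ∷ xs) ys = trans (cong (f x ∨_) (any-++ f xs ys)) (sym (∨-assoc (f x) (any f xs) (any f ys)))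

any-false : ∀ {A : Set} (f : A → Bool) xs → (∀ x → f x ≡ false) → any f xs ≡ false
any-false f [] f-false = refl
any-false f (x ∷ xs) f-false rewrite f-false x = any-false f xs f-false

any-cong : ∀ {A : Set} {f g : A → Bool} → (∀ x → f x ≡ g x) → ∀ xs → any f xs ≡ any g xs
any-cong f≗g [] = refl
any-cong f≗g (x ∷ xs) = cong₂ _∨_ (f≗g x) (any-cong f≗g xs)

all-applyUpTo⁻ : ∀ (p : ℕ → Bool) f n → all p (applyUpTo f n) ≡ true → ∀ i → i < n → p (f i) ≡ true
all-applyUpTo⁻ p f (suc n) all-p zero _ = proj₁ (∧-true⁻ all-p)
all-applyUpTo⁻ p f (suc n) all-p (suc i) i<n =
  all-applyUpTo⁻ p (λ x → f (suc x)) n (proj₂ (∧-true⁻ {p (f zero)} all-p)) i (s≤s⁻¹ i<n)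

all-applyUpTo⁺ : ∀ (p : ℕ → Bool) f n → (∀ i → i < n → p (f i) ≡ true) → all p (applyUpTo f n) ≡ true
all-applyUpTo⁺ p f zero _ = refl
all-applyUpTo⁺ p f (suc n) p-f rewrite p-f zero (s≤s z≤n) =
  all-applyUpTo⁺ p (λ x → f (suc x)) n (λ i i<n → p-f (suc i) (s≤s i<n))

multiplicity : ℕ → List ℕ → ℕ
multiplicity y [] = 0
multiplicity y (x ∷ xs) = if y ≡ᵇ x then suc (multiplicity y xs) else multiplicity y xs

multiplicity-++ : ∀ y xs ys → multiplicity y (xs ++ ys) ≡ multiplicity y xs + multiplicity y ys
multiplicity-++ y [] ys = refl
multiplicity-++ y (x ∷ xs) ys with y ≡ᵇ x
... | true = cong suc (multiplicity-++ y xs ys)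
... | false = multiplicity-++ y xs ys

elem⇒multiplicity>0 : ∀ y xs → elem y xs ≡ true → 0 < multiplicity y xs
elem⇒multiplicity>0 y (x ∷ xs) y∈ with y ≡ᵇ x
... | true = s≤s z≤n
... | false = elem⇒multiplicity>0 y xs y∈

multiplicity>0⇒elem : ∀ y xs → 0 < multiplicity y xs → elem y xs ≡ true
multiplicity>0⇒elem y (x ∷ xs) pos with y ≡ᵇ x
... | true = refl
... | false = multiplicity>0⇒elem y xs pos

multiplicity≡0⇒¬elem : ∀ y xs → multiplicity y xs ≡ 0 → elem y xs ≡ false
multiplicity≡0⇒¬elem y [] _ = refl
multiplicity≡0⇒¬elem y (x ∷ xs) none with y ≡ᵇ x
... | false = multiplicity≡0⇒¬elem y xs none

¬elem⇒multiplicity≡0 : ∀ y xs → elem y xs ≡ false → multiplicity y xs ≡ 0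
¬elem⇒multiplicity≡0 y [] _ = refl
¬elem⇒multiplicity≡0 y (x ∷ xs) y∉ with y ≡ᵇ x
... | false = ¬elem⇒multiplicity≡0 y xs y∉

delete : ℕ → List ℕ → List ℕ
delete y [] = []
delete y (x ∷ xs) = if y ≡ᵇ x then xs else x ∷ delete y xs

length-delete : ∀ y xs → elem y xs ≡ true → suc (length (delete y xs)) ≡ length xs
length-delete y (x ∷ xs) y∈ with y ≡ᵇ x
... | true = refl
... | false = cong suc (length-delete y xs y∈)

elem-delete-≢ : ∀ {j} y xs → j ≢ y → elem j (delete y xs) ≡ elem j xs
elem-delete-≢ y [] _ = refl
elem-delete-≢ {j} y (x ∷ xs) j≢y with y ≡ᵇ x in eq
... | true rewrite ≡ᵇ-true⁻ {y} eq | ≡ᵇ-false j≢y = refl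
... | false = cong ((j ≡ᵇ x) ∨_) (elem-delete-≢ y xs j≢y)

elem-delete-repeated : ∀ y xs → 2 ≤ multiplicity y xs → elem y (delete y xs) ≡ true
elem-delete-repeated y (x ∷ xs) twice with y ≡ᵇ x in eq
... | true = multiplicity>0⇒elem y xs (s≤s⁻¹ twice)
... | false rewrite eq = elem-delete-repeated y xs twice

Covers : ℕ → List ℕ → Set
Covers n xs = ∀ i → i < n → elem (suc i) xs ≡ true

covers-delete : ∀ {n} y xs → Covers n xs → (∀ i → i < n → suc i ≡ y → elem y (delete y xs) ≡ true) →
  Covers n (delete y xs)
covers-delete y xs cov keep i i<n with suc i ≟ y
... | yes si≡y = subst (λ j → elem j (delete y xs) ≡ true) (sym si≡y) (keep i i<n si≡y)
... | no si≢y = trans (elem-delete-≢ y xs si≢y) (cov i i<n)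

covers⇒≤length : ∀ n xs → Covers n xs → n ≤ length xs
covers⇒≤length zero xs _ = z≤n
covers⇒≤length (suc n) xs cov = subst (suc n ≤_) (length-delete (suc n) xs (cov n ≤-refl))
  (s≤s (covers⇒≤length n (delete (suc n) xs) (covers-delete (suc n) xs (λ i i<n → cov i (m<n⇒m<1+n i<n))
                                           (λ i i<n si≡sn → ⊥-elim (<-irrefl (suc-injective si≡sn) i<n)))))

covers-delete-member : ∀ {n} y xs → Covers n (delete y xs) → elem y xs ≡ true → length xs ≢ n
covers-delete-member {n} y xs cov y∈ len≡n =
  1+n≰n (subst (_≤ length (delete y xs)) len-del (covers⇒≤length n (delete y xs) cov))
  where
  len-del : n ≡ suc (length (delete y xs))
  len-del = trans (sym len≡n) (sym (length-delete y xs y∈))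

covering-labels-bounded : ∀ {n} xs → Covers n xs → length xs ≡ n → ∀ y → elem y xs ≡ true → y ≤ n
covering-labels-bounded {n} xs cov len y y∈ with y ≤? n
... | yes y≤n = y≤n
... | no y≰n = ⊥-elim (covers-delete-member y xs (covers-delete y xs cov keep) y∈ len)
  where
  keep : ∀ i → i < n → suc i ≡ y → elem y (delete y xs) ≡ true
  keep i i<n si≡y = ⊥-elim (y≰n (subst (_≤ n) si≡y i<n))

covering-top-unique : ∀ {n} xs → Covers (suc n) xs → length xs ≡ suc n → multiplicity (suc n) xs ≡ 1
covering-top-unique {n} xs cov len with multiplicity (suc n) xs in mult
... | zero = ⊥-elim (1+n≰n (subst (0 <_) mult (elem⇒multiplicity>0 (suc n) xs (cov n ≤-refl))))
... | suc zero = refl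
... | suc (suc _) = ⊥-elim (covers-delete-member (suc n) xs (covers-delete (suc n) xs cov keep) (cov n ≤-refl) len)
  where
  keep : ∀ i → i < suc n → suc i ≡ suc n → elem (suc n) (delete (suc n) xs) ≡ true
  keep _ _ _ = elem-delete-repeated (suc n) xs (subst (2 ≤_) (sym mult) (s≤s (s≤s z≤n)))

size : Tree → ℕ
size t = length (labels t)

size-node : ∀ a b → size (node a b) ≡ size a + size b
size-node a b = length-++ (labels a)

size>0 : ∀ t → 0 < size t
size>0 (leaf _) = s≤s z≤n
size>0 (node a b) = subst (0 <_) (sym (size-node a b)) (≤-trans (size>0 a) (m≤m+n (size a) (size b)))

bijLabelled⁻ : ∀ n t → bijLabelled n t ≡ true → size t ≡ n × Covers n (labels t)
bijLabelled⁻ n t bij with ∧-true⁻ {length (labels t) ≡ᵇ n} bij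
... | size≡n , all-in = ≡ᵇ-true⁻ size≡n , all-applyUpTo⁻ (λ i → elem (suc i) (labels t)) (λ x → x) n all-in

bijLabelled⁺ : ∀ n t → size t ≡ n → Covers n (labels t) → bijLabelled n t ≡ true
bijLabelled⁺ n t refl cov rewrite ≡ᵇ-refl (size t) = all-applyUpTo⁺ (λ i → elem (suc i) (labels t)) (λ x → x) (size t) cov

elem-node : ∀ y a b → elem y (labels (node a b)) ≡ elem y (labels a) ∨ elem y (labels b)
elem-node y a b = any-++ _ (labels a) (labels b)

elem-left : ∀ y a b → elem y (labels a) ≡ true → elem y (labels (node a b)) ≡ true
elem-left y a b y∈a = trans (elem-node y a b) (cong (_∨ elem y (labels b)) y∈a)

elem-right : ∀ y a b → elem y (labels b) ≡ true → elem y (labels (node a b)) ≡ true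
elem-right y a b y∈b = trans (elem-node y a b) (trans (cong (elem y (labels a) ∨_) y∈b) (∨-zeroʳ _))

minLab∈labels : ∀ t → elem (minLab t) (labels t) ≡ true
minLab∈labels (leaf x) rewrite ≡ᵇ-refl x = refl
minLab∈labels (node a b) with ⊓-sel (minLab a) (minLab b)
... | inj₁ eq = subst (λ y → elem y (labels (node a b)) ≡ true) (sym eq) (elem-left (minLab a) a b (minLab∈labels a))
... | inj₂ eq = subst (λ y → elem y (labels (node a b)) ≡ true) (sym eq) (elem-right (minLab b) a b (minLab∈labels b))

AllLabels : (ℕ → Set) → Tree → Set
AllLabels P t = ∀ y → elem y (labels t) ≡ true → P y

AllLabels-left : ∀ {P} a b → AllLabels P (node a b) → AllLabels P a
AllLabels-left a b all y y∈a = all y (elem-left y a b y∈a)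

AllLabels-right : ∀ {P} a b → AllLabels P (node a b) → AllLabels P b
AllLabels-right a b all y y∈b = all y (elem-right y a b y∈b)

AllLabels-minLab : ∀ {P} t → AllLabels P t → P (minLab t)
AllLabels-minLab t all = all (minLab t) (minLab∈labels t)

below⇒∉ : ∀ {m} t → AllLabels (_< m) t → elem m (labels t) ≡ false
below⇒∉ {m} t below with elem m (labels t) in m∈t
... | false = refl
... | true = ⊥-elim (<-irrefl refl (below m m∈t))

ordered-node⁻ : ∀ a b → ordered (node a b) ≡ true → minLab a < minLab b × ordered a ≡ true × ordered b ≡ true
ordered-node⁻ a b ord with ∧-true⁻ {minLab a <ᵇ minLab b} ord
... | a<b , ord-ab with ∧-true⁻ {ordered a} ord-ab
... | ord-a , ord-b = <ᵇ-true⁻ a<b , ord-a , ord-b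

ordered-node⁺ : ∀ a b → minLab a < minLab b → ordered a ≡ true → ordered b ≡ true → ordered (node a b) ≡ true
ordered-node⁺ a b a<b ord-a ord-b rewrite <ᵇ-true a<b | ord-a | ord-b = refl

minLab-ordered : ∀ a b → ordered (node a b) ≡ true → minLab (node a b) ≡ minLab a
minLab-ordered a b ord with ordered-node⁻ a b ord
... | a<b , _ = m≤n⇒m⊓n≡m (<⇒≤ a<b)

-- Occurrences of three-leaf patterns

matches : Tree → Tree → Bool
matches P s = st s == P

occurs : Tree → Tree → Bool
occurs P t = any (matches P) (subtrees t)

anyNodeCut : (Tree → Bool) → Tree → Tree → Bool
anyNodeCut f a b = any (λ p → any (λ q → f (node p q)) (cuts b)) (cuts a)

any-cuts : ∀ f a b → any f (cuts (node a b)) ≡ f (leaf (minLab (node a b))) ∨ anyNodeCut f a b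
any-cuts f a b = cong (f (leaf (minLab (node a b))) ∨_) (any-concat (cuts a))
  where
  any-map : ∀ x ys → any f (map (node x) ys) ≡ any (λ q → f (node x q)) ys
  any-map x [] = refl
  any-map x (y ∷ ys) = cong (f (node x y) ∨_) (any-map x ys)
  any-concat : ∀ xs → any f (concatMap (λ x → map (node x) (cuts b)) xs)
                      ≡ any (λ p → any (λ q → f (node p q)) (cuts b)) xs
  any-concat [] = refl
  any-concat (x ∷ xs) = trans (any-++ f (map (node x) (cuts b)) _) (cong₂ _∨_ (any-map x (cuts b)) (any-concat xs))

any-cuts-node : ∀ f a b → f (leaf (minLab (node a b))) ≡ false →
  any f (cuts (node a b)) ≡ anyNodeCut f a b
any-cuts-node f a b f-root = trans (any-cuts f a b) (cong (_∨ anyNodeCut f a b) f-root)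

any-cuts-leaf : ∀ f c → (∀ p q → f (node p q) ≡ false) → any f (cuts c) ≡ f (leaf (minLab c))
any-cuts-leaf f (leaf n) f-node = ∨-identityʳ (f (leaf n))
any-cuts-leaf f (node a b) f-node =
  trans (any-cuts f a b) (trans (cong (f (leaf (minLab (node a b))) ∨_) grafted-false) (∨-identityʳ _))
  where
  grafted-false : anyNodeCut f a b ≡ false
  grafted-false = any-false _ (cuts a) (λ p → any-false _ (cuts b) (f-node p))

shape : Tree → Tree
shape (leaf _) = leaf 0
shape (node a b) = node (shape a) (shape b)

shape-relabel : ∀ xs s → shape (relabel xs s) ≡ shape s
shape-relabel xs (leaf _) = refl
shape-relabel xs (node a b) = cong₂ node (shape-relabel xs a) (shape-relabel xs b)

==⇒shape≡ : ∀ s t → s == t ≡ true → shape s ≡ shape t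
==⇒shape≡ (leaf _) (leaf _) _ = refl
==⇒shape≡ (node a b) (node c d) eq with a == c in ac | b == d in bd
... | true | true = cong₂ node (==⇒shape≡ a c ac) (==⇒shape≡ b d bd)

matches-shape : ∀ P s → shape s ≢ shape P → matches P s ≡ false
matches-shape P s s≉P with st s == P in eq
... | false = refl
... | true = ⊥-elim (s≉P (trans (sym (shape-relabel (labels s) s)) (==⇒shape≡ (st s) P eq)))

leftComb rightComb : ℕ → ℕ → ℕ → Tree
leftComb i j k = node (node (leaf i) (leaf j)) (leaf k)
rightComb i j k = node (leaf i) (node (leaf j) (leaf k))

-- Of all cuts of node (node a₁ a₂) b only the one of the pattern's shape can match it, and its
-- leaves carry the minima of a₁, a₂ and b.

module _ (i j k : ℕ) where

  private
    g : Tree → Bool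
    g = matches (leftComb i j k)

  any-cuts-leftComb : ∀ a₁ a₂ b →
    any g (cuts (node (node a₁ a₂) b)) ≡ g (leftComb (minLab a₁) (minLab a₂) (minLab b))
  any-cuts-leftComb a₁ a₂ b = begin
    any g (cuts (node (node a₁ a₂) b))
      ≡⟨ any-cuts-node g (node a₁ a₂) b refl ⟩
    any (λ p → any (λ q → g (node p q)) (cuts b)) (cuts (node a₁ a₂))
      ≡⟨ any-cong (λ p → any-cuts-leaf (λ q → g (node p q)) b (λ _ _ → ∧-zeroʳ _)) (cuts (node a₁ a₂)) ⟩
    any (λ p → g (node p (leaf (minLab b)))) (cuts (node a₁ a₂))
      ≡⟨ any-cuts-node (λ p → g (node p (leaf (minLab b)))) a₁ a₂ refl ⟩
    any (λ p → any (λ q → g (node (node p q) (leaf (minLab b)))) (cuts a₂)) (cuts a₁)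
      ≡⟨ any-cuts-leaf (λ p → any (λ q → g (node (node p q) (leaf (minLab b)))) (cuts a₂)) a₁
           (λ _ _ → any-false _ (cuts a₂) (λ _ → refl)) ⟩
    any (λ q → g (node (node (leaf (minLab a₁)) q) (leaf (minLab b)))) (cuts a₂)
      ≡⟨ any-cuts-leaf (λ q → g (node (node (leaf (minLab a₁)) q) (leaf (minLab b)))) a₂
           (λ q r → matches-shape (leftComb i j k)
                      (node (node (leaf (minLab a₁)) (node q r)) (leaf (minLab b))) (λ ())) ⟩
    g (leftComb (minLab a₁) (minLab a₂) (minLab b)) ∎
    where open ≡-Reasoning

  any-cuts-leftComb-leaf : ∀ u b → any g (cuts (node (leaf u) b)) ≡ false
  any-cuts-leftComb-leaf u b =
    trans (any-cuts-node g (leaf u) b refl) (cong (_∨ false) (any-false _ (cuts b) (λ _ → refl)))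

module _ (i j k : ℕ) where

  private
    g : Tree → Bool
    g = matches (rightComb i j k)

  any-cuts-rightComb : ∀ a b₁ b₂ →
    any g (cuts (node a (node b₁ b₂))) ≡ g (rightComb (minLab a) (minLab b₁) (minLab b₂))
  any-cuts-rightComb a b₁ b₂ = begin
    any g (cuts (node a (node b₁ b₂)))
      ≡⟨ any-cuts-node g a (node b₁ b₂) refl ⟩
    any (λ p → any (λ q → g (node p q)) (cuts (node b₁ b₂))) (cuts a)
      ≡⟨ any-cuts-leaf (λ p → any (λ q → g (node p q)) (cuts (node b₁ b₂))) a
           (λ _ _ → any-false _ (cuts (node b₁ b₂)) (λ _ → refl)) ⟩
    any (λ q → g (node (leaf (minLab a)) q)) (cuts (node b₁ b₂))
      ≡⟨ any-cuts-node (λ q → g (node (leaf (minLab a)) q)) b₁ b₂ (∧-zeroʳ _) ⟩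
    any (λ p → any (λ q → g (node (leaf (minLab a)) (node p q))) (cuts b₂)) (cuts b₁)
      ≡⟨ any-cuts-leaf (λ p → any (λ q → g (node (leaf (minLab a)) (node p q))) (cuts b₂)) b₁
           (λ _ _ → any-false _ (cuts b₂) (λ _ → ∧-zeroʳ _)) ⟩
    any (λ q → g (node (leaf (minLab a)) (node (leaf (minLab b₁)) q))) (cuts b₂)
      ≡⟨ any-cuts-leaf (λ q → g (node (leaf (minLab a)) (node (leaf (minLab b₁)) q))) b₂
           (λ q r → matches-shape (rightComb i j k)
                      (node (leaf (minLab a)) (node (leaf (minLab b₁)) (node q r))) (λ ())) ⟩
    g (rightComb (minLab a) (minLab b₁) (minLab b₂)) ∎
    where open ≡-Reasoning

  any-cuts-rightComb-leaf : ∀ a v → any g (cuts (node a (leaf v))) ≡ false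
  any-cuts-rightComb-leaf a v = trans (any-cuts-node g a (leaf v) refl)
    (any-false _ (cuts a) (λ p → cong (_∨ false) (∧-zeroʳ _)))

rank-∷-< : ∀ {a x} xs → a < x → rank (a ∷ xs) x ≡ suc (rank xs x)
rank-∷-< xs a<x rewrite <ᵇ-true a<x = refl

rank-∷-≥ : ∀ {a x} xs → x ≤ a → rank (a ∷ xs) x ≡ rank xs x
rank-∷-≥ xs x≤a rewrite <ᵇ-false x≤a = refl

relabel-leftComb : ∀ xs u v w {i j k} → rank xs u ≡ i → rank xs v ≡ j → rank xs w ≡ k →
  relabel xs (leftComb u v w) ≡ leftComb i j k
relabel-leftComb xs u v w refl refl refl = refl

relabel-rightComb : ∀ xs u v w {i j k} → rank xs u ≡ i → rank xs v ≡ j → rank xs w ≡ k →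
  relabel xs (rightComb u v w) ≡ rightComb i j k
relabel-rightComb xs u v w refl refl refl = refl

module _ {u v w : ℕ} (u<v : u < v) (u<w : u < w) where

  private
    rank-u : rank (u ∷ v ∷ w ∷ []) u ≡ 1
    rank-u = trans (rank-∷-≥ (v ∷ w ∷ []) (≤-refl {u}))
               (trans (rank-∷-≥ (w ∷ []) (<⇒≤ u<v)) (rank-∷-≥ [] (<⇒≤ u<w)))

  st-leftComb-< : v < w → st (leftComb u v w) ≡ leftComb 1 2 3
  st-leftComb-< v<w = relabel-leftComb (u ∷ v ∷ w ∷ []) u v w rank-u
    (trans (rank-∷-< (v ∷ w ∷ []) u<v)
       (cong suc (trans (rank-∷-≥ (w ∷ []) (≤-refl {v})) (rank-∷-≥ [] (<⇒≤ v<w)))))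
    (trans (rank-∷-< (v ∷ w ∷ []) u<w)
       (cong suc (trans (rank-∷-< (w ∷ []) v<w) (cong suc (rank-∷-≥ [] (≤-refl {w}))))))

  st-leftComb-> : w < v → st (leftComb u v w) ≡ leftComb 1 3 2
  st-leftComb-> w<v = relabel-leftComb (u ∷ v ∷ w ∷ []) u v w rank-u
    (trans (rank-∷-< (v ∷ w ∷ []) u<v)
       (cong suc (trans (rank-∷-≥ (w ∷ []) (≤-refl {v})) (rank-∷-< [] w<v))))
    (trans (rank-∷-< (v ∷ w ∷ []) u<w)
       (cong suc (trans (rank-∷-≥ (w ∷ []) (<⇒≤ w<v)) (rank-∷-≥ [] (≤-refl {w})))))

  st-leftComb-≡ : v ≡ w → st (leftComb u v w) ≡ leftComb 1 2 2
  st-leftComb-≡ refl = relabel-leftComb (u ∷ v ∷ v ∷ []) u v v rank-u rank-v rank-v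
    where
    rank-v : rank (u ∷ v ∷ v ∷ []) v ≡ 2
    rank-v = trans (rank-∷-< (v ∷ v ∷ []) u<v)
               (cong suc (trans (rank-∷-≥ (v ∷ []) (≤-refl {v})) (rank-∷-≥ [] (≤-refl {v}))))

  st-rightComb : v < w → st (rightComb u v w) ≡ rightComb 1 2 3
  st-rightComb v<w = relabel-rightComb (u ∷ v ∷ w ∷ []) u v w rank-u
    (trans (rank-∷-< (v ∷ w ∷ []) u<v)
       (cong suc (trans (rank-∷-≥ (w ∷ []) (≤-refl {v})) (rank-∷-≥ [] (<⇒≤ v<w)))))
    (trans (rank-∷-< (v ∷ w ∷ []) u<w)
       (cong suc (trans (rank-∷-< (w ∷ []) v<w) (cong suc (rank-∷-≥ [] (≤-refl {w}))))))

matches-123 : ∀ {u v w} → u < v → u < w → matches p123 (leftComb u v w) ≡ (v <ᵇ w)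
matches-123 {u} {v} {w} u<v u<w with <-cmp v w
... | tri< v<w _ _ = trans (cong (_== p123) (st-leftComb-< u<v u<w v<w)) (sym (<ᵇ-true v<w))
... | tri≈ _ v≡w _ = trans (cong (_== p123) (st-leftComb-≡ u<v u<w v≡w)) (sym (<ᵇ-false (≤-reflexive (sym v≡w))))
... | tri> _ _ w<v = trans (cong (_== p123) (st-leftComb-> u<v u<w w<v)) (sym (<ᵇ-false (<⇒≤ w<v)))

matches-132 : ∀ {u v w} → u < v → u < w → matches p132 (leftComb u v w) ≡ (w <ᵇ v)
matches-132 {u} {v} {w} u<v u<w with <-cmp v w
... | tri< v<w _ _ = trans (cong (_== p132) (st-leftComb-< u<v u<w v<w)) (sym (<ᵇ-false (<⇒≤ v<w)))
... | tri≈ _ v≡w _ = trans (cong (_== p132) (st-leftComb-≡ u<v u<w v≡w)) (sym (<ᵇ-false (≤-reflexive v≡w)))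
... | tri> _ _ w<v = trans (cong (_== p132) (st-leftComb-> u<v u<w w<v)) (sym (<ᵇ-true w<v))

matches-1-23 : ∀ {u v w} → u < v → v < w → matches p1-23 (rightComb u v w) ≡ true
matches-1-23 u<v v<w = cong (_== p1-23) (st-rightComb u<v (<-trans u<v v<w) v<w)

Local : Set
Local = Tree → Tree → Bool

somewhere : Local → Tree → Bool
somewhere at (leaf _) = false
somewhere at (node a b) = at a b ∨ somewhere at a ∨ somewhere at b

at123 at132 at1-23 : Local
at123 (leaf _) b = false
at123 (node _ a₂) b = minLab a₂ <ᵇ minLab b
at132 (leaf _) b = false
at132 (node _ a₂) b = minLab b <ᵇ minLab a₂
at1-23 a (leaf _) = false
at1-23 a (node _ _) = true

somewhere-node⁺ : ∀ at a b → at a b ≡ false → somewhere at a ≡ false → somewhere at b ≡ false →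
  somewhere at (node a b) ≡ false
somewhere-node⁺ at a b at-ab at-a at-b rewrite at-ab | at-a | at-b = refl

somewhere-node⁻ : ∀ at a b → somewhere at (node a b) ≡ false →
  at a b ≡ false × somewhere at a ≡ false × somewhere at b ≡ false
somewhere-node⁻ at a b none with ∨-false⁻ {at a b} none
... | at-ab , none-ab with ∨-false⁻ {somewhere at a} none-ab
... | none-a , none-b = at-ab , none-a , none-b

ordered-leftComb : ∀ a₁ a₂ b → ordered (node (node a₁ a₂) b) ≡ true →
  minLab a₁ < minLab a₂ × minLab a₁ < minLab b
ordered-leftComb a₁ a₂ b ord with ordered-node⁻ (node a₁ a₂) b ord
... | a<b , ord-a , _ with ordered-node⁻ a₁ a₂ ord-a
... | a₁<a₂ , _ = a₁<a₂ , subst (_< minLab b) (minLab-ordered a₁ a₂ ord-a) a<b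

ordered-rightComb : ∀ a b₁ b₂ → ordered (node a (node b₁ b₂)) ≡ true →
  minLab a < minLab b₁ × minLab b₁ < minLab b₂
ordered-rightComb a b₁ b₂ ord with ordered-node⁻ a (node b₁ b₂) ord
... | a<b , _ , ord-b with ordered-node⁻ b₁ b₂ ord-b
... | b₁<b₂ , _ = subst (minLab a <_) (minLab-ordered b₁ b₂ ord-b) a<b , b₁<b₂

occurs-somewhere : ∀ P at → (∀ a b → ordered (node a b) ≡ true → any (matches P) (cuts (node a b)) ≡ at a b) →
  ∀ t → ordered t ≡ true → occurs P t ≡ somewhere at t
occurs-somewhere P at root (leaf _) _ = refl
occurs-somewhere P at root (node a b) ord with ordered-node⁻ a b ord
... | _ , ord-a , ord-b = begin
  occurs P (node a b)
    ≡⟨ any-++ (matches P) (cuts (node a b)) _ ⟩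
  any (matches P) (cuts (node a b)) ∨ any (matches P) (subtrees a ++ subtrees b)
    ≡⟨ cong₂ _∨_ (root a b ord) (any-++ (matches P) (subtrees a) (subtrees b)) ⟩
  at a b ∨ occurs P a ∨ occurs P b
    ≡⟨ cong (λ x → at a b ∨ x) (cong₂ _∨_ (occurs-somewhere P at root a ord-a) (occurs-somewhere P at root b ord-b)) ⟩
  somewhere at (node a b) ∎
  where open ≡-Reasoning

occurs-123 : ∀ t → ordered t ≡ true → occurs p123 t ≡ somewhere at123 t
occurs-123 = occurs-somewhere p123 at123 root
  where
  root : ∀ a b → ordered (node a b) ≡ true → any (matches p123) (cuts (node a b)) ≡ at123 a b
  root (leaf u) b _ = any-cuts-leftComb-leaf 1 2 3 u b
  root (node a₁ a₂) b ord with ordered-leftComb a₁ a₂ b ord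
  ... | u<v , u<w = trans (any-cuts-leftComb 1 2 3 a₁ a₂ b) (matches-123 u<v u<w)

occurs-132 : ∀ t → ordered t ≡ true → occurs p132 t ≡ somewhere at132 t
occurs-132 = occurs-somewhere p132 at132 root
  where
  root : ∀ a b → ordered (node a b) ≡ true → any (matches p132) (cuts (node a b)) ≡ at132 a b
  root (leaf u) b _ = any-cuts-leftComb-leaf 1 3 2 u b
  root (node a₁ a₂) b ord with ordered-leftComb a₁ a₂ b ord
  ... | u<v , u<w = trans (any-cuts-leftComb 1 3 2 a₁ a₂ b) (matches-132 u<v u<w)

occurs-1-23 : ∀ t → ordered t ≡ true → occurs p1-23 t ≡ somewhere at1-23 t
occurs-1-23 = occurs-somewhere p1-23 at1-23 root
  where
  root : ∀ a b → ordered (node a b) ≡ true → any (matches p1-23) (cuts (node a b)) ≡ at1-23 a b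
  root a (leaf v) _ = any-cuts-rightComb-leaf 1 2 3 a v
  root a (node b₁ b₂) ord with ordered-rightComb a b₁ b₂ ord
  ... | u<v , v<w = trans (any-cuts-rightComb 1 2 3 a b₁ b₂) (matches-1-23 u<v v<w)

-- Removing and grafting the largest label

module MaxLeaf (m : ℕ) where

  isLeaf-m : Tree → Bool
  isLeaf-m (leaf x) = m ≡ᵇ x
  isLeaf-m (node _ _) = false

  remove : Tree → Tree
  remove (leaf x) = leaf x
  remove (node a b) =
    if isLeaf-m b then a else if elem m (labels a) then node (remove a) b else node a (remove b)

  remove-root : ∀ a → remove (node a (leaf m)) ≡ a
  remove-root a rewrite ≡ᵇ-refl m = refl

  remove-left : ∀ a b → isLeaf-m b ≡ false → elem m (labels a) ≡ true → remove (node a b) ≡ node (remove a) b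
  remove-left a b b≢m m∈a rewrite b≢m | m∈a = refl

  remove-right : ∀ a b → isLeaf-m b ≡ false → elem m (labels a) ≡ false → remove (node a b) ≡ node a (remove b)
  remove-right a b b≢m m∉a rewrite b≢m | m∉a = refl

  record TopLabelled (t : Tree) : Set where
    field
      once : multiplicity m (labels t) ≡ 1
      bounded : AllLabels (_≤ m) t
      ordered-t : ordered t ≡ true
  open TopLabelled public

  minLab<m : ∀ b → multiplicity m (labels b) ≡ 0 → AllLabels (_≤ m) b → minLab b < m
  minLab<m b m∉b b≤m = ≤∧≢⇒< (AllLabels-minLab b b≤m) minLab≢m
    where
    minLab≢m : minLab b ≢ m
    minLab≢m refl = true≢false (trans (sym (minLab∈labels b)) (multiplicity≡0⇒¬elem m (labels b) m∉b))

  TopLabelled-left : ∀ a b → TopLabelled (node a b) → multiplicity m (labels a) ≡ 1 → TopLabelled a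
  TopLabelled-left a b top once-a = record
    { once = once-a
    ; bounded = AllLabels-left a b (bounded top)
    ; ordered-t = proj₁ (proj₂ (ordered-node⁻ a b (ordered-t top)))
    }

  TopLabelled-right : ∀ a b → TopLabelled (node a b) → multiplicity m (labels b) ≡ 1 → TopLabelled b
  TopLabelled-right a b top once-b = record
    { once = once-b
    ; bounded = AllLabels-right a b (bounded top)
    ; ordered-t = proj₂ (proj₂ (ordered-node⁻ a b (ordered-t top)))
    }

  once-node : ∀ a b → TopLabelled (node a b) → multiplicity m (labels a) + multiplicity m (labels b) ≡ 1
  once-node a b top = trans (sym (multiplicity-++ m (labels a) (labels b))) (once top)

  data Position : Tree → Tree → Set where
    at-root : ∀ a → Position a (leaf m)
    in-left : ∀ {a₁ a₂ b} → isLeaf-m b ≡ false → elem m (labels (node a₁ a₂)) ≡ true →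
      TopLabelled (node a₁ a₂) → multiplicity m (labels b) ≡ 0 → Position (node a₁ a₂) b
    in-right : ∀ {a b₁ b₂} → elem m (labels a) ≡ false → TopLabelled (node b₁ b₂) → Position a (node b₁ b₂)

  position : ∀ a b → TopLabelled (node a b) → Position a b
  position a b top with isLeaf-m b in b≟m | elem m (labels a) in m∈a
  position a (leaf x) top | true | _ = subst (λ y → Position a (leaf y)) (≡ᵇ-true⁻ b≟m) (at-root a)
  -- A left child carries the smaller minimum, so the largest label is never a left leaf.
  position (leaf x) b top | false | true = ⊥-elim (<⇒≱ m<b b≤m)
    where
    m<b : m < minLab b
    m<b = subst (_< minLab b) (sym (≡ᵇ-true⁻ (trans (sym (∨-identityʳ (m ≡ᵇ x))) m∈a)))
            (proj₁ (ordered-node⁻ (leaf x) b (ordered-t top)))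
    b≤m : minLab b ≤ m
    b≤m = AllLabels-minLab b (AllLabels-right (leaf x) b (bounded top))
  position (node a₁ a₂) b top | false | true = in-left b≟m m∈a (TopLabelled-left (node a₁ a₂) b top once-a) m∉b
    where
    once-a : multiplicity m (labels (node a₁ a₂)) ≡ 1
    once-a = ≤-antisym (subst (multiplicity m (labels (node a₁ a₂)) ≤_) (once-node (node a₁ a₂) b top) (m≤m+n _ _))
                       (elem⇒multiplicity>0 m (labels (node a₁ a₂)) m∈a)
    m∉b : multiplicity m (labels b) ≡ 0
    m∉b = +-cancelˡ-≡ 1 _ 0 (trans (cong (_+ multiplicity m (labels b)) (sym once-a)) (once-node (node a₁ a₂) b top))
  position a (leaf x) top | false | false =
    ⊥-elim (0≢1+n (trans (sym (¬elem⇒multiplicity≡0 m (labels (node a (leaf x))) m∉t)) (once top)))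
    where
    m∉t : elem m (labels (node a (leaf x))) ≡ false
    m∉t = trans (elem-node m a (leaf x)) (cong₂ _∨_ m∈a (cong (_∨ false) b≟m))
  position a (node b₁ b₂) top | false | false = in-right m∈a (TopLabelled-right a (node b₁ b₂) top once-b)
    where
    once-b : multiplicity m (labels (node b₁ b₂)) ≡ 1
    once-b = trans (cong (_+ multiplicity m (labels (node b₁ b₂))) (sym (¬elem⇒multiplicity≡0 m (labels a) m∈a)))
                   (once-node a (node b₁ b₂) top)

  record Removal (t r : Tree) : Set where
    field
      size-removal : suc (size r) ≡ size t
      elem-removal : ∀ y → y ≢ m → elem y (labels r) ≡ elem y (labels t)
      ordered-removal : ordered r ≡ true
      minLab-removal : minLab r ≡ minLab t
  open Removal public

  removal : ∀ a b → TopLabelled (node a b) → Removal (node a b) (remove (node a b))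
  removal a b top with position a b top | ordered-node⁻ a b (ordered-t top)
  ... | at-root a | a<m , ord-a , _ = subst (Removal (node a (leaf m))) (sym (remove-root a)) (record
    { size-removal = sym (trans (size-node a (leaf m)) (+-comm (size a) 1))
    ; elem-removal = λ y y≢m → sym (trans (elem-node y a (leaf m))
                                   (trans (cong (λ z → elem y (labels a) ∨ (z ∨ false)) (≡ᵇ-false y≢m)) (∨-identityʳ _)))
    ; ordered-removal = ord-a
    ; minLab-removal = sym (m≤n⇒m⊓n≡m (<⇒≤ a<m))
    })
  ... | in-left {a₁} {a₂} b≢m m∈a top-a _ | a<b , _ , ord-b =
    subst (Removal (node (node a₁ a₂) b)) (sym (remove-left (node a₁ a₂) b b≢m m∈a)) (record
    { size-removal = trans (cong suc (size-node (remove a) b))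
                       (trans (cong (_+ size b) (size-removal ih)) (sym (size-node a b)))
    ; elem-removal = λ y y≢m → trans (elem-node y (remove a) b)
                                 (trans (cong (_∨ elem y (labels b)) (elem-removal ih y y≢m)) (sym (elem-node y a b)))
    ; ordered-removal = ordered-node⁺ (remove a) b (subst (_< minLab b) (sym (minLab-removal ih)) a<b)
                          (ordered-removal ih) ord-b
    ; minLab-removal = cong (_⊓ minLab b) (minLab-removal ih)
    })
    where
    ih : Removal (node a₁ a₂) (remove (node a₁ a₂))
    ih = removal a₁ a₂ top-a
  ... | in-right {b₁ = b₁} {b₂} m∉a top-b | a<b , ord-a , _ =
    subst (Removal (node a (node b₁ b₂))) (sym (remove-right a (node b₁ b₂) refl m∉a)) (record
    { size-removal = trans (cong suc (size-node a (remove b)))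
                       (trans (sym (+-suc (size a) _)) (trans (cong (size a +_) (size-removal ih)) (sym (size-node a b))))
    ; elem-removal = λ y y≢m → trans (elem-node y a (remove b))
                                 (trans (cong (elem y (labels a) ∨_) (elem-removal ih y y≢m)) (sym (elem-node y a b)))
    ; ordered-removal = ordered-node⁺ a (remove b) (subst (minLab a <_) (sym (minLab-removal ih)) a<b)
                          ord-a (ordered-removal ih)
    ; minLab-removal = cong (minLab a ⊓_) (minLab-removal ih)
    })
    where
    ih : Removal (node b₁ b₂) (remove (node b₁ b₂))
    ih = removal b₁ b₂ top-b

  data Graft : Tree → Tree → Set where
    graft-root : ∀ t → Graft t (node t (leaf m))
    graft-left : ∀ {a a′} b → Graft a a′ → Graft (node a b) (node a′ b)
    graft-right : ∀ a {b b′} → Graft b b′ → Graft (node a b) (node a b′)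

  size-graft : ∀ {t r} → Graft t r → size r ≡ suc (size t)
  size-graft (graft-root t) = trans (size-node t (leaf m)) (+-comm (size t) 1)
  size-graft (graft-left {a} {a′} b g) =
    trans (size-node a′ b) (trans (cong (_+ size b) (size-graft g)) (cong suc (sym (size-node a b))))
  size-graft (graft-right a {b} {b′} g) =
    trans (size-node a b′)
      (trans (cong (size a +_) (size-graft g)) (trans (+-suc (size a) (size b)) (cong suc (sym (size-node a b)))))

  elem-graft : ∀ {t r} → Graft t r → ∀ y → elem y (labels r) ≡ elem y (labels t) ∨ (y ≡ᵇ m)
  elem-graft (graft-root t) y = trans (elem-node y t (leaf m)) (cong (elem y (labels t) ∨_) (∨-identityʳ (y ≡ᵇ m)))
  elem-graft (graft-left {a} {a′} b g) y = begin
    elem y (labels (node a′ b))                          ≡⟨ elem-node y a′ b ⟩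
    elem y (labels a′) ∨ elem y (labels b)               ≡⟨ cong (_∨ elem y (labels b)) (elem-graft g y) ⟩
    (elem y (labels a) ∨ (y ≡ᵇ m)) ∨ elem y (labels b)   ≡⟨ ∨-∨-swap (elem y (labels a)) (y ≡ᵇ m) (elem y (labels b)) ⟩
    (elem y (labels a) ∨ elem y (labels b)) ∨ (y ≡ᵇ m)   ≡⟨ cong (_∨ (y ≡ᵇ m)) (sym (elem-node y a b)) ⟩
    elem y (labels (node a b)) ∨ (y ≡ᵇ m)                ∎
    where open ≡-Reasoning
  elem-graft (graft-right a {b} {b′} g) y = begin
    elem y (labels (node a b′))                          ≡⟨ elem-node y a b′ ⟩
    elem y (labels a) ∨ elem y (labels b′)               ≡⟨ cong (elem y (labels a) ∨_) (elem-graft g y) ⟩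
    elem y (labels a) ∨ (elem y (labels b) ∨ (y ≡ᵇ m))   ≡⟨ sym (∨-assoc (elem y (labels a)) (elem y (labels b)) (y ≡ᵇ m)) ⟩
    (elem y (labels a) ∨ elem y (labels b)) ∨ (y ≡ᵇ m)   ≡⟨ cong (_∨ (y ≡ᵇ m)) (sym (elem-node y a b)) ⟩
    elem y (labels (node a b)) ∨ (y ≡ᵇ m)                ∎
    where open ≡-Reasoning

  m∈graft : ∀ {t r} → Graft t r → elem m (labels r) ≡ true
  m∈graft {t} g = trans (elem-graft g m) (trans (cong (elem m (labels t) ∨_) (≡ᵇ-refl m)) (∨-zeroʳ _))

  minLab-graft : ∀ {t r} → Graft t r → AllLabels (_< m) t → minLab r ≡ minLab t
  minLab-graft (graft-root t) below = m≤n⇒m⊓n≡m (<⇒≤ (AllLabels-minLab t below))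
  minLab-graft (graft-left {a} b g) below = cong (_⊓ minLab b) (minLab-graft g (AllLabels-left a b below))
  minLab-graft (graft-right a {b} g) below = cong (minLab a ⊓_) (minLab-graft g (AllLabels-right a b below))

  ordered-graft : ∀ {t r} → Graft t r → AllLabels (_< m) t → ordered t ≡ true → ordered r ≡ true
  ordered-graft (graft-root t) below ord = ordered-node⁺ t (leaf m) (AllLabels-minLab t below) ord refl
  ordered-graft (graft-left {a} {a′} b g) below ord with ordered-node⁻ a b ord
  ... | a<b , ord-a , ord-b =
    ordered-node⁺ a′ b (subst (_< minLab b) (sym (minLab-graft g (AllLabels-left a b below))) a<b)
      (ordered-graft g (AllLabels-left a b below) ord-a) ord-b
  ordered-graft (graft-right a {b} {b′} g) below ord with ordered-node⁻ a b ord
  ... | a<b , ord-a , ord-b =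
    ordered-node⁺ a b′ (subst (minLab a <_) (sym (minLab-graft g (AllLabels-right a b below))) a<b)
      ord-a (ordered-graft g (AllLabels-right a b below) ord-b)

  graft-not-leaf : ∀ {t r} → Graft t r → isLeaf-m r ≡ false
  graft-not-leaf (graft-root _) = refl
  graft-not-leaf (graft-left _ _) = refl
  graft-not-leaf (graft-right _ _) = refl

  ¬leaf-m : ∀ b → elem m (labels b) ≡ false → isLeaf-m b ≡ false
  ¬leaf-m (leaf x) m∉b = trans (sym (∨-identityʳ (m ≡ᵇ x))) m∉b
  ¬leaf-m (node _ _) _ = refl

  remove-graft : ∀ {t r} → Graft t r → elem m (labels t) ≡ false → remove r ≡ t
  remove-graft (graft-root t) _ = remove-root t
  remove-graft (graft-left {a} {a′} b g) m∉t with ∨-false⁻ (trans (sym (elem-node m a b)) m∉t)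
  ... | m∉a , m∉b = trans (remove-left a′ b (¬leaf-m b m∉b) (m∈graft g)) (cong (λ z → node z b) (remove-graft g m∉a))
  remove-graft (graft-right a {b} {b′} g) m∉t with ∨-false⁻ (trans (sym (elem-node m a b)) m∉t)
  ... | m∉a , m∉b = trans (remove-right a b′ (graft-not-leaf g) m∉a) (cong (node a) (remove-graft g m∉b))

  ∉-beside-root : ∀ a → TopLabelled (node a (leaf m)) → elem m (labels a) ≡ false
  ∉-beside-root a top = multiplicity≡0⇒¬elem m (labels a) (+-cancelʳ-≡ 1 _ 0 once-a)
    where
    once-a : multiplicity m (labels a) + 1 ≡ 1
    once-a = subst (λ k → multiplicity m (labels a) + k ≡ 1) (cong (λ b → if b then 1 else 0) (≡ᵇ-refl m))
                   (once-node a (leaf m) top)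

  -- The number of leaves to the left of the sibling of the leaf m.
  offset : Tree → ℕ
  offset (leaf _) = 0
  offset (node a b) = if isLeaf-m b then 0 else if elem m (labels a) then offset a else size a + offset b

  offset-root : ∀ a → offset (node a (leaf m)) ≡ 0
  offset-root a rewrite ≡ᵇ-refl m = refl

  offset-left : ∀ a b → isLeaf-m b ≡ false → elem m (labels a) ≡ true → offset (node a b) ≡ offset a
  offset-left a b b≢m m∈a rewrite b≢m | m∈a = refl

  offset-right : ∀ a b → isLeaf-m b ≡ false → elem m (labels a) ≡ false → offset (node a b) ≡ size a + offset b
  offset-right a b b≢m m∉a rewrite b≢m | m∉a = refl

-- Counting avoiders through an insertion scheme

record Reinsertion (at : Local) (insert : Tree → ℕ → Tree) (t r : Tree) (i : ℕ) : Set where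
  field
    avoids-removed : somewhere at r ≡ false
    index<size : i < size r
    insert-removed : insert r i ≡ t
open Reinsertion public

record InsertionScheme (at : Local) : Set where
  field
    insert : ℕ → Tree → ℕ → Tree
    index : ℕ → Tree → ℕ
    graft-insert : ∀ m t i → MaxLeaf.Graft m t (insert m t i)
    index-insert : ∀ m t i → i < size t → AllLabels (_< m) t → somewhere at t ≡ false →
      index m (insert m t i) ≡ i
    avoids-insert : ∀ m t i → i < size t → AllLabels (_< m) t → somewhere at t ≡ false →
      somewhere at (insert m t i) ≡ false
    reinsertion : ∀ m a b → MaxLeaf.TopLabelled m (node a b) → somewhere at (node a b) ≡ false →
      Reinsertion at (insert m) (node a b) (MaxLeaf.remove m (node a b)) (index m (node a b))

record Avoider (at : Local) (n : ℕ) (t : Tree) : Set where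
  field
    avoider-size : size t ≡ n
    avoider-covers : Covers n (labels t)
    avoider-ordered : ordered t ≡ true
    avoider-avoids : somewhere at t ≡ false
open Avoider public

module Counting {P : Tree} {at : Local} (occurs≡ : ∀ t → ordered t ≡ true → occurs P t ≡ somewhere at t)
                (scheme : InsertionScheme at) where

  open InsertionScheme scheme

  avoider⁻ : ∀ {n} t → T (isTree n t ∧ avoids P t) → Avoider at n t
  avoider⁻ {n} t v with ∧-true⁻ {isTree n t} (Equivalence.to T-≡ v)
  ... | is-tree , avoids-t with ∧-true⁻ {bijLabelled n t} is-tree
  ... | bij , ord with bijLabelled⁻ n t bij
  ... | size≡n , cov = record
    { avoider-size = size≡n
    ; avoider-covers = cov
    ; avoider-ordered = ord
    ; avoider-avoids = trans (sym (occurs≡ t ord)) (not-true⁻ avoids-t)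
    }

  avoider⁺ : ∀ {n} t → Avoider at n t → T (isTree n t ∧ avoids P t)
  avoider⁺ {n} t av = Equivalence.from T-≡ (cong₂ _∧_
    (cong₂ _∧_ (bijLabelled⁺ n t (avoider-size av) (avoider-covers av)) (avoider-ordered av))
    (cong not (trans (occurs≡ t (avoider-ordered av)) (avoider-avoids av))))

  Avoiders-≡ : ∀ {n t t′} → t ≡ t′ →
    (v : T (isTree n t ∧ avoids P t)) (v′ : T (isTree n t′ ∧ avoids P t′)) →
    _≡_ {A = Avoiders P n} (t , v) (t′ , v′)
  Avoiders-≡ refl v v′ = cong (_ ,_) (T-irrelevant v v′)

  no-Avoiders-0 : ¬ Avoiders P 0
  no-Avoiders-0 (t , v) = <-irrefl (sym (avoider-size (avoider⁻ t v))) (size>0 t)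

  Avoiders-1 : Avoiders P 1 ↔ Fin 1
  Avoiders-1 = mk↔ₛ′ (λ _ → zero) (λ _ → leaf 1 , _) (λ { zero → refl }) single
    where
    single : ∀ t → (leaf 1 , _) ≡ t
    single (leaf x , v) = Avoiders-≡ (cong leaf (sym x≡1)) _ v
      where
      x≡1 : x ≡ 1
      x≡1 = sym (≡ᵇ-true⁻ (trans (sym (∨-identityʳ (1 ≡ᵇ x)))
                                 (avoider-covers (avoider⁻ {1} (leaf x) v) 0 (s≤s z≤n))))
    single (node a b , v) = ⊥-elim (<-irrefl (sym (avoider-size (avoider⁻ (node a b) v))) size>1)
      where
      size>1 : 1 < size (node a b)
      size>1 = subst (1 <_) (sym (size-node a b)) (+-mono-≤ (size>0 a) (size>0 b))

  module Step (k : ℕ) where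

    private
      n m : ℕ
      n = suc k
      m = suc n

    open MaxLeaf m

    top-labelled : ∀ t → Avoider at m t → TopLabelled t
    top-labelled t av = record
      { once = covering-top-unique (labels t) (avoider-covers av) (avoider-size av)
      ; bounded = covering-labels-bounded (labels t) (avoider-covers av) (avoider-size av)
      ; ordered-t = avoider-ordered av
      }

    removal-of : ∀ t → Avoider at m t → Removal t (remove t) × Reinsertion at (insert m) t (remove t) (index m t)
    removal-of (leaf x) av with avoider-size av
    ... | ()
    removal-of (node a b) av =
      removal a b (top-labelled (node a b) av) , reinsertion m a b (top-labelled (node a b) av) (avoider-avoids av)

    size-remove : ∀ t → Avoider at m t → size (remove t) ≡ n
    size-remove t av = suc-injective (trans (size-removal (proj₁ (removal-of t av))) (avoider-size av))

    index<n : ∀ t → Avoider at m t → index m t < n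
    index<n t av = subst (index m t <_) (size-remove t av) (index<size (proj₂ (removal-of t av)))

    remove-avoider : ∀ t → Avoider at m t → Avoider at n (remove t)
    remove-avoider t av = record
      { avoider-size = size-remove t av
      ; avoider-covers = λ j j<n → trans (elem-removal R (suc j) (λ sj≡m → <-irrefl (suc-injective sj≡m) j<n))
                                         (avoider-covers av j (m<n⇒m<1+n j<n))
      ; avoider-ordered = ordered-removal R
      ; avoider-avoids = avoids-removed (proj₂ (removal-of t av))
      }
      where
      R : Removal t (remove t)
      R = proj₁ (removal-of t av)

    below-m : ∀ t → Avoider at n t → AllLabels (_< m) t
    below-m t av y y∈t = s≤s (covering-labels-bounded (labels t) (avoider-covers av) (avoider-size av) y y∈t)

    toℕ<size : ∀ {t} (i : Fin n) → Avoider at n t → toℕ i < size t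
    toℕ<size i av = subst (toℕ i <_) (sym (avoider-size av)) (toℕ<n i)

    insert-avoider : ∀ (i : Fin n) t → Avoider at n t → Avoider at m (insert m t (toℕ i))
    insert-avoider i t av = record
      { avoider-size = trans (size-graft g) (cong suc (avoider-size av))
      ; avoider-covers = covers
      ; avoider-ordered = ordered-graft g (below-m t av) (avoider-ordered av)
      ; avoider-avoids = avoids-insert m t (toℕ i) (toℕ<size i av) (below-m t av) (avoider-avoids av)
      }
      where
      g : Graft t (insert m t (toℕ i))
      g = graft-insert m t (toℕ i)
      covers : Covers m (labels (insert m t (toℕ i)))
      covers j j<m with j ≟ n
      ... | yes refl = m∈graft g
      ... | no j≢n = trans (elem-graft g (suc j))
                       (cong (_∨ (suc j ≡ᵇ m)) (avoider-covers av j (≤∧≢⇒< (s≤s⁻¹ j<m) j≢n)))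

    to : Avoiders P m → Fin n × Avoiders P n
    to (t , v) = fromℕ< (index<n t (avoider⁻ t v)) , (remove t , avoider⁺ (remove t) (remove-avoider t (avoider⁻ t v)))

    from : Fin n × Avoiders P n → Avoiders P m
    from (i , (t , v)) = insert m t (toℕ i) , avoider⁺ _ (insert-avoider i t (avoider⁻ t v))

    to∘from : ∀ y → to (from y) ≡ y
    to∘from (i , (t , v)) = cong₂ _,_
      (trans (fromℕ<-cong _ _ (index-insert m t (toℕ i) (toℕ<size i av) (below-m t av) (avoider-avoids av)) _ (toℕ<n i))
             (fromℕ<-toℕ i (toℕ<n i)))
      (Avoiders-≡ (remove-graft (graft-insert m t (toℕ i)) (below⇒∉ t (below-m t av))) _ v)
      where
      av : Avoider at n t
      av = avoider⁻ t v

    from∘to : ∀ x → from (to x) ≡ x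
    from∘to (t , v) = Avoiders-≡ (trans (cong (insert m (remove t)) (toℕ-fromℕ< (index<n t av)))
                                        (insert-removed (proj₂ (removal-of t av)))) _ v
      where
      av : Avoider at m t
      av = avoider⁻ t v

    step : Avoiders P m ↔ (Fin n × Avoiders P n)
    step = mk↔ₛ′ to from to∘from from∘to

  Avoiders↔Fin! : ∀ n → Avoiders P (suc n) ↔ Fin (n !)
  Avoiders↔Fin! zero = Avoiders-1
  Avoiders↔Fin! (suc k) = ↔-trans (Step.step k) (↔-trans (↔-refl ×-↔ Avoiders↔Fin! k) (↔-sym (*↔× {suc k} {k !})))

-- The three insertion schemes

index-right : ∀ a b {i} → size a ≤ i → i < size (node a b) → i ∸ size a < size b
index-right a b a≤i i<ab =
  subst (_ <_) (m+n∸m≡n (size a) (size b)) (∸-monoˡ-< (subst (_ <_) (size-node a b) i<ab) a≤i)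

at123-minLab : ∀ a {b b′} → minLab b′ ≡ minLab b → at123 a b′ ≡ at123 a b
at123-minLab (leaf _) _ = refl
at123-minLab (node _ a₂) b′≡b = cong (minLab a₂ <ᵇ_) b′≡b

module OnLeaf (m : ℕ) where

  open MaxLeaf m

  -- Grafts m as the right sibling of the i-th leaf (counting from 0).
  graftOnLeaf : Tree → ℕ → Tree
  graftOnLeaf (leaf x) i = node (leaf x) (leaf m)
  graftOnLeaf (node a b) i = if i <ᵇ size a then node (graftOnLeaf a i) b else node a (graftOnLeaf b (i ∸ size a))

  graftOnLeaf-left : ∀ a b {i} → i < size a → graftOnLeaf (node a b) i ≡ node (graftOnLeaf a i) b
  graftOnLeaf-left a b i<a rewrite <ᵇ-true i<a = refl

  graftOnLeaf-right : ∀ a b {i} → size a ≤ i → graftOnLeaf (node a b) i ≡ node a (graftOnLeaf b (i ∸ size a))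
  graftOnLeaf-right a b a≤i rewrite <ᵇ-false a≤i = refl

  graft-leaf : ∀ t i → Graft t (graftOnLeaf t i)
  graft-leaf (leaf x) i = graft-root (leaf x)
  graft-leaf (node a b) i with i <? size a
  ... | yes i<a rewrite graftOnLeaf-left a b i<a = graft-left b (graft-leaf a i)
  ... | no i≮a rewrite graftOnLeaf-right a b (≮⇒≥ i≮a) = graft-right a (graft-leaf b (i ∸ size a))

  offset-graft : ∀ t i → i < size t → AllLabels (_< m) t → offset (graftOnLeaf t i) ≡ i
  offset-graft (leaf x) zero _ _ = offset-root (leaf x)
  offset-graft (leaf x) (suc i) (s≤s ()) _
  offset-graft (node a b) i i<t below with i <? size a
  ... | yes i<a rewrite graftOnLeaf-left a b i<a =
    trans (offset-left (graftOnLeaf a i) b (¬leaf-m b (below⇒∉ b (AllLabels-right a b below))) (m∈graft (graft-leaf a i)))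
          (offset-graft a i i<a (AllLabels-left a b below))
  ... | no i≮a rewrite graftOnLeaf-right a b (≮⇒≥ i≮a) =
    trans (offset-right a (graftOnLeaf b j) (graft-not-leaf (graft-leaf b j)) (below⇒∉ a (AllLabels-left a b below)))
          (trans (cong (size a +_) (offset-graft b j (index-right a b (≮⇒≥ i≮a) i<t) (AllLabels-right a b below)))
                 (m+[n∸m]≡n (≮⇒≥ i≮a)))
    where
    j : ℕ
    j = i ∸ size a

  at123-graft-left : ∀ {a a′} b → Graft a a′ → AllLabels (_< m) a → AllLabels (_< m) b →
    at123 a b ≡ false → at123 a′ b ≡ false
  at123-graft-left b (graft-root _) _ below-b _ = <ᵇ-false (<⇒≤ (AllLabels-minLab b below-b))
  at123-graft-left b (graft-left _ _) _ _ at-ab = at-ab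
  at123-graft-left b (graft-right a₁ {a₂} g) below _ at-ab =
    trans (cong (_<ᵇ minLab b) (minLab-graft g (AllLabels-right a₁ a₂ below))) at-ab

  avoids-graft : ∀ t i → AllLabels (_< m) t → somewhere at123 t ≡ false →
    somewhere at123 (graftOnLeaf t i) ≡ false
  avoids-graft (leaf x) i _ _ = refl
  avoids-graft (node a b) i below none with somewhere-node⁻ at123 a b none | i <? size a
  ... | at-ab , none-a , none-b | yes i<a rewrite graftOnLeaf-left a b i<a =
    somewhere-node⁺ at123 (graftOnLeaf a i) b
      (at123-graft-left b (graft-leaf a i) (AllLabels-left a b below) (AllLabels-right a b below) at-ab)
      (avoids-graft a i (AllLabels-left a b below) none-a) none-b
  ... | at-ab , none-a , none-b | no i≮a rewrite graftOnLeaf-right a b (≮⇒≥ i≮a) =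
    somewhere-node⁺ at123 a (graftOnLeaf b j)
      (trans (at123-minLab a (minLab-graft (graft-leaf b j) (AllLabels-right a b below))) at-ab)
      none-a (avoids-graft b j (AllLabels-right a b below) none-b)
    where
    j : ℕ
    j = i ∸ size a

  root-sibling-leaf : ∀ a → TopLabelled (node a (leaf m)) → at123 a (leaf m) ≡ false → ∃ λ x → a ≡ leaf x
  root-sibling-leaf (leaf x) _ _ = x , refl
  -- Avoidance at the root would force min a₂ = m, a second occurrence of m.
  root-sibling-leaf (node a₁ a₂) top at-a = ⊥-elim (true≢false (trans (sym m∈a) (∉-beside-root (node a₁ a₂) top)))
    where
    a₂≡m : minLab a₂ ≡ m
    a₂≡m = ≤-antisym (AllLabels-minLab a₂ (AllLabels-right a₁ a₂ (AllLabels-left (node a₁ a₂) (leaf m) (bounded top))))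
                     (<ᵇ-false⁻ at-a)
    m∈a : elem m (labels (node a₁ a₂)) ≡ true
    m∈a = elem-right m a₁ a₂ (subst (λ y → elem y (labels a₂) ≡ true) a₂≡m (minLab∈labels a₂))

  at123-remove : ∀ a₁ a₂ b → TopLabelled (node a₁ a₂) → somewhere at123 (node a₁ a₂) ≡ false →
    at123 (node a₁ a₂) b ≡ false → at123 (remove (node a₁ a₂)) b ≡ false
  at123-remove a₁ a₂ b top none at-ab with position a₁ a₂ top
  ... | at-root a₁ with root-sibling-leaf a₁ top (proj₁ (somewhere-node⁻ at123 a₁ (leaf m) none))
  ... | x , refl rewrite remove-root (leaf x) = refl
  at123-remove a₁ a₂ b top none at-ab | in-left a₂≢m m∈a₁ _ _ rewrite remove-left a₁ a₂ a₂≢m m∈a₁ = at-ab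
  at123-remove a₁ (node b₁ b₂) b top none at-ab | in-right m∉a₁ top-a₂
    rewrite remove-right a₁ (node b₁ b₂) refl m∉a₁ =
    trans (cong (_<ᵇ minLab b) (minLab-removal (removal b₁ b₂ top-a₂))) at-ab

  reinsert : ∀ a b → TopLabelled (node a b) → somewhere at123 (node a b) ≡ false →
    Reinsertion at123 graftOnLeaf (node a b) (remove (node a b)) (offset (node a b))
  reinsert a b top none with position a b top | somewhere-node⁻ at123 a b none
  ... | at-root a | at-a , _ with root-sibling-leaf a top at-a
  ... | x , refl rewrite remove-root (leaf x) | offset-root (leaf x) =
    record { avoids-removed = refl ; index<size = s≤s z≤n ; insert-removed = refl }
  reinsert a b top none | in-left {a₁} {a₂} b≢m m∈a top-a _ | at-ab , none-a , none-b
    rewrite remove-left (node a₁ a₂) b b≢m m∈a | offset-left (node a₁ a₂) b b≢m m∈a = record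
    { avoids-removed = somewhere-node⁺ at123 (remove a) b (at123-remove a₁ a₂ b top-a none-a at-ab) (avoids-removed ih) none-b
    ; index<size = subst (offset a <_) (sym (size-node (remove a) b)) (<-≤-trans (index<size ih) (m≤m+n _ _))
    ; insert-removed = trans (graftOnLeaf-left (remove a) b (index<size ih)) (cong (λ t → node t b) (insert-removed ih))
    }
    where
    ih : Reinsertion at123 graftOnLeaf a (remove a) (offset a)
    ih = reinsert a₁ a₂ top-a none-a
  reinsert a b top none | in-right {b₁ = b₁} {b₂} m∉a top-b | at-ab , none-a , none-b
    rewrite remove-right a b refl m∉a | offset-right a b refl m∉a = record
    { avoids-removed = somewhere-node⁺ at123 a (remove b) (trans (at123-minLab a (minLab-removal (removal b₁ b₂ top-b))) at-ab)
                         none-a (avoids-removed ih)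
    ; index<size = subst (size a + offset b <_) (sym (size-node a (remove b))) (+-monoʳ-< (size a) (index<size ih))
    ; insert-removed = trans (graftOnLeaf-right a (remove b) (m≤m+n _ _))
                             (cong (node a) (trans (cong (graftOnLeaf (remove b)) (m+n∸m≡n (size a) _)) (insert-removed ih)))
    }
    where
    ih : Reinsertion at123 graftOnLeaf b (remove b) (offset b)
    ih = reinsert b₁ b₂ top-b none-b

at132-minLab : ∀ a {b b′} → minLab b′ ≡ minLab b → at132 a b′ ≡ at132 a b
at132-minLab (leaf _) _ = refl
at132-minLab (node _ a₂) b′≡b = cong (_<ᵇ minLab a₂) b′≡b

module OnMaximal (m : ℕ) where

  open MaxLeaf m

  -- Grafts m as the right sibling of the largest subtree whose leftmost leaf is the i-th leaf.
  graftOnMaximal : Tree → ℕ → Tree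
  graftOnMaximal t zero = node t (leaf m)
  graftOnMaximal (leaf x) (suc _) = node (leaf x) (leaf m)
  graftOnMaximal (node a b) (suc k) =
    if suc k <ᵇ size a then node (graftOnMaximal a (suc k)) b else node a (graftOnMaximal b (suc k ∸ size a))

  graftOnMaximal-left : ∀ a b {i} → 0 < i → i < size a → graftOnMaximal (node a b) i ≡ node (graftOnMaximal a i) b
  graftOnMaximal-left a b (s≤s z≤n) i<a rewrite <ᵇ-true i<a = refl

  graftOnMaximal-right : ∀ a b {i} → 0 < i → size a ≤ i →
    graftOnMaximal (node a b) i ≡ node a (graftOnMaximal b (i ∸ size a))
  graftOnMaximal-right a b (s≤s z≤n) a≤i rewrite <ᵇ-false a≤i = refl

  graft-maximal : ∀ t i → Graft t (graftOnMaximal t i)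
  graft-maximal t zero = graft-root t
  graft-maximal (leaf x) (suc k) = graft-root (leaf x)
  graft-maximal (node a b) (suc k) with suc k <? size a
  ... | yes i<a rewrite graftOnMaximal-left a b (s≤s z≤n) i<a = graft-left b (graft-maximal a (suc k))
  ... | no i≮a rewrite graftOnMaximal-right a b (s≤s z≤n) (≮⇒≥ i≮a) = graft-right a (graft-maximal b (suc k ∸ size a))

  offset-graft : ∀ t i → i < size t → AllLabels (_< m) t → offset (graftOnMaximal t i) ≡ i
  offset-graft t zero _ _ = offset-root t
  offset-graft (leaf x) (suc i) (s≤s ()) _
  offset-graft (node a b) (suc k) i<t below with suc k <? size a
  ... | yes i<a rewrite graftOnMaximal-left a b (s≤s z≤n) i<a =
    trans (offset-left (graftOnMaximal a (suc k)) b (¬leaf-m b (below⇒∉ b (AllLabels-right a b below)))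
                       (m∈graft (graft-maximal a (suc k))))
          (offset-graft a (suc k) i<a (AllLabels-left a b below))
  ... | no i≮a rewrite graftOnMaximal-right a b (s≤s z≤n) (≮⇒≥ i≮a) =
    trans (offset-right a (graftOnMaximal b j) (graft-not-leaf (graft-maximal b j)) (below⇒∉ a (AllLabels-left a b below)))
          (trans (cong (size a +_) (offset-graft b j (index-right a b (≮⇒≥ i≮a) i<t) (AllLabels-right a b below)))
                 (m+[n∸m]≡n (≮⇒≥ i≮a)))
    where
    j : ℕ
    j = suc k ∸ size a

  at132-graft-left : ∀ a b i → 0 < i → i < size a → AllLabels (_< m) a →
    at132 (graftOnMaximal a i) b ≡ at132 a b
  at132-graft-left (leaf x) b (suc _) _ (s≤s ()) _
  at132-graft-left (node a₁ a₂) b i 0<i i<a below with i <? size a₁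
  ... | yes i<a₁ rewrite graftOnMaximal-left a₁ a₂ 0<i i<a₁ = refl
  ... | no i≮a₁ rewrite graftOnMaximal-right a₁ a₂ 0<i (≮⇒≥ i≮a₁) =
    cong (minLab b <ᵇ_) (minLab-graft (graft-maximal a₂ (i ∸ size a₁)) (AllLabels-right a₁ a₂ below))

  avoids-graft : ∀ t i → i < size t → AllLabels (_< m) t → somewhere at132 t ≡ false →
    somewhere at132 (graftOnMaximal t i) ≡ false
  avoids-graft (leaf x) zero _ _ _ = refl
  avoids-graft (leaf x) (suc i) _ _ _ = refl
  avoids-graft (node a₁ a₂) zero _ below none =
    somewhere-node⁺ at132 (node a₁ a₂) (leaf m)
      (<ᵇ-false (<⇒≤ (AllLabels-minLab a₂ (AllLabels-right a₁ a₂ below)))) none refl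
  avoids-graft (node a b) (suc k) i<t below none with somewhere-node⁻ at132 a b none | suc k <? size a
  ... | at-ab , none-a , none-b | yes i<a rewrite graftOnMaximal-left a b (s≤s z≤n) i<a =
    somewhere-node⁺ at132 (graftOnMaximal a (suc k)) b
      (trans (at132-graft-left a b (suc k) (s≤s z≤n) i<a (AllLabels-left a b below)) at-ab)
      (avoids-graft a (suc k) i<a (AllLabels-left a b below) none-a) none-b
  ... | at-ab , none-a , none-b | no i≮a rewrite graftOnMaximal-right a b (s≤s z≤n) (≮⇒≥ i≮a) =
    somewhere-node⁺ at132 a (graftOnMaximal b j)
      (trans (at132-minLab a (minLab-graft (graft-maximal b j) (AllLabels-right a b below))) at-ab)
      none-a (avoids-graft b j (index-right a b (≮⇒≥ i≮a) i<t) (AllLabels-right a b below) none-b)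
    where
    j : ℕ
    j = suc k ∸ size a

  offset>0 : ∀ a₁ a₂ b → TopLabelled (node a₁ a₂) → somewhere at132 (node a₁ a₂) ≡ false →
    at132 (node a₁ a₂) b ≡ false → minLab b < m → 0 < offset (node a₁ a₂)
  offset>0 a₁ a₂ b top none at-ab b<m with position a₁ a₂ top
  ... | at-root a₁ = ⊥-elim (true≢false (trans (sym (<ᵇ-true b<m)) at-ab))
  ... | in-left {c₁} {c₂} a₂≢m m∈a₁ top-a₁ m∉a₂ with somewhere-node⁻ at132 (node c₁ c₂) a₂ none
  ...   | at-a , none-a₁ , _ rewrite offset-left (node c₁ c₂) a₂ a₂≢m m∈a₁ =
    offset>0 c₁ c₂ a₂ top-a₁ none-a₁ at-a (minLab<m a₂ m∉a₂ (AllLabels-right (node c₁ c₂) a₂ (bounded top)))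
  offset>0 a₁ (node b₁ b₂) b top none at-ab b<m | in-right m∉a₁ _ rewrite offset-right a₁ (node b₁ b₂) refl m∉a₁ =
    ≤-trans (size>0 a₁) (m≤m+n _ _)

  at132-remove : ∀ a₁ a₂ b → TopLabelled (node a₁ a₂) → at132 (node a₁ a₂) b ≡ false → minLab b < m →
    at132 (remove (node a₁ a₂)) b ≡ false
  at132-remove a₁ a₂ b top at-ab b<m with position a₁ a₂ top
  ... | at-root a₁ = ⊥-elim (true≢false (trans (sym (<ᵇ-true b<m)) at-ab))
  ... | in-left a₂≢m m∈a₁ _ _ rewrite remove-left a₁ a₂ a₂≢m m∈a₁ = at-ab
  at132-remove a₁ (node b₁ b₂) b top at-ab b<m | in-right m∉a₁ top-a₂
    rewrite remove-right a₁ (node b₁ b₂) refl m∉a₁ =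
    trans (cong (minLab b <ᵇ_) (minLab-removal (removal b₁ b₂ top-a₂))) at-ab

  reinsert : ∀ a b → TopLabelled (node a b) → somewhere at132 (node a b) ≡ false →
    Reinsertion at132 graftOnMaximal (node a b) (remove (node a b)) (offset (node a b))
  reinsert a b top none with position a b top | somewhere-node⁻ at132 a b none
  ... | at-root a | _ , none-a , _ rewrite remove-root a | offset-root a =
    record { avoids-removed = none-a ; index<size = size>0 a ; insert-removed = refl }
  ... | in-left {a₁} {a₂} b≢m m∈a top-a m∉b | at-ab , none-a , none-b
    rewrite remove-left (node a₁ a₂) b b≢m m∈a | offset-left (node a₁ a₂) b b≢m m∈a = record
    { avoids-removed = somewhere-node⁺ at132 (remove a) b (at132-remove a₁ a₂ b top-a at-ab b<m) (avoids-removed ih) none-b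
    ; index<size = subst (offset a <_) (sym (size-node (remove a) b)) (<-≤-trans (index<size ih) (m≤m+n _ _))
    ; insert-removed = trans (graftOnMaximal-left (remove a) b (offset>0 a₁ a₂ b top-a none-a at-ab b<m) (index<size ih))
                             (cong (λ t → node t b) (insert-removed ih))
    }
    where
    b<m : minLab b < m
    b<m = minLab<m b m∉b (AllLabels-right a b (bounded top))
    ih : Reinsertion at132 graftOnMaximal a (remove a) (offset a)
    ih = reinsert a₁ a₂ top-a none-a
  ... | in-right {b₁ = b₁} {b₂} m∉a top-b | at-ab , none-a , none-b
    rewrite remove-right a b refl m∉a | offset-right a b refl m∉a = record
    { avoids-removed = somewhere-node⁺ at132 a (remove b) (trans (at132-minLab a (minLab-removal (removal b₁ b₂ top-b))) at-ab)
                         none-a (avoids-removed ih)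
    ; index<size = subst (size a + offset b <_) (sym (size-node a (remove b))) (+-monoʳ-< (size a) (index<size ih))
    ; insert-removed = trans (graftOnMaximal-right a (remove b) (≤-trans (size>0 a) (m≤m+n _ _)) (m≤m+n _ _))
                             (cong (node a) (trans (cong (graftOnMaximal (remove b)) (m+n∸m≡n (size a) _)) (insert-removed ih)))
    }
    where
    ih : Reinsertion at132 graftOnMaximal b (remove b) (offset b)
    ih = reinsert b₁ b₂ top-b none-b

module Spine (m : ℕ) where

  open MaxLeaf m

  -- Grafts m as the right sibling of the vertex at depth d on the left spine.
  graftOnSpine : Tree → ℕ → Tree
  graftOnSpine t zero = node t (leaf m)
  graftOnSpine (leaf x) (suc d) = node (leaf x) (leaf m)
  graftOnSpine (node a b) (suc d) = node (graftOnSpine a d) b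

  spineDepth : Tree → ℕ
  spineDepth (leaf _) = 0
  spineDepth (node a b) = if isLeaf-m b then 0 else suc (spineDepth a)

  spineDepth-root : ∀ a → spineDepth (node a (leaf m)) ≡ 0
  spineDepth-root a rewrite ≡ᵇ-refl m = refl

  spineDepth-left : ∀ a b → isLeaf-m b ≡ false → spineDepth (node a b) ≡ suc (spineDepth a)
  spineDepth-left a b b≢m rewrite b≢m = refl

  graft-spine : ∀ t d → Graft t (graftOnSpine t d)
  graft-spine t zero = graft-root t
  graft-spine (leaf x) (suc d) = graft-root (leaf x)
  graft-spine (node a b) (suc d) = graft-left b (graft-spine a d)

  at1-23-false⁻ : ∀ a b → at1-23 a b ≡ false → ∃ λ x → b ≡ leaf x
  at1-23-false⁻ a (leaf x) _ = x , refl

  spineDepth-graft : ∀ t d → d < size t → AllLabels (_< m) t → somewhere at1-23 t ≡ false →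
    spineDepth (graftOnSpine t d) ≡ d
  spineDepth-graft t zero _ _ _ = spineDepth-root t
  spineDepth-graft (leaf x) (suc d) (s≤s ()) _ _
  spineDepth-graft (node a b) (suc d) d<t below none with somewhere-node⁻ at1-23 a b none
  ... | at-ab , none-a , _ with at1-23-false⁻ a b at-ab
  ... | x , refl = trans (spineDepth-left (graftOnSpine a d) (leaf x) (¬leaf-m (leaf x) (below⇒∉ (leaf x) below-x)))
                         (cong suc (spineDepth-graft a d d<a (AllLabels-left a (leaf x) below) none-a))
    where
    below-x : AllLabels (_< m) (leaf x)
    below-x = AllLabels-right a (leaf x) below
    d<a : d < size a
    d<a = s≤s⁻¹ (subst (suc d <_) (trans (size-node a (leaf x)) (+-comm (size a) 1)) d<t)

  avoids-graft : ∀ t d → somewhere at1-23 t ≡ false → somewhere at1-23 (graftOnSpine t d) ≡ false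
  avoids-graft t zero none = somewhere-node⁺ at1-23 t (leaf m) refl none refl
  avoids-graft (leaf x) (suc d) _ = refl
  avoids-graft (node a b) (suc d) none with somewhere-node⁻ at1-23 a b none
  ... | at-ab , none-a , none-b with at1-23-false⁻ a b at-ab
  ... | x , refl = somewhere-node⁺ at1-23 (graftOnSpine a d) (leaf x) refl (avoids-graft a d none-a) none-b

  reinsert : ∀ a b → TopLabelled (node a b) → somewhere at1-23 (node a b) ≡ false →
    Reinsertion at1-23 graftOnSpine (node a b) (remove (node a b)) (spineDepth (node a b))
  reinsert a b top none with position a b top | somewhere-node⁻ at1-23 a b none
  ... | at-root a | _ , none-a , _ rewrite remove-root a | spineDepth-root a =
    record { avoids-removed = none-a ; index<size = size>0 a ; insert-removed = refl }
  ... | in-left {a₁} {a₂} {leaf x} x≢m m∈a top-a _ | _ , none-a , _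
    rewrite remove-left (node a₁ a₂) (leaf x) x≢m m∈a | spineDepth-left (node a₁ a₂) (leaf x) x≢m = record
    { avoids-removed = somewhere-node⁺ at1-23 (remove (node a₁ a₂)) (leaf x) refl (avoids-removed ih) refl
    ; index<size = subst (suc (spineDepth (node a₁ a₂)) <_)
                     (sym (trans (size-node (remove (node a₁ a₂)) (leaf x)) (+-comm _ 1))) (s≤s (index<size ih))
    ; insert-removed = cong (λ t → node t (leaf x)) (insert-removed ih)
    }
    where
    ih : Reinsertion at1-23 graftOnSpine (node a₁ a₂) (remove (node a₁ a₂)) (spineDepth (node a₁ a₂))
    ih = reinsert a₁ a₂ top-a none-a
  ... | in-left {b = node _ _} _ _ _ _ | () , _
  ... | in-right _ _ | () , _

scheme123 : InsertionScheme at123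
scheme123 = record
  { insert = OnLeaf.graftOnLeaf
  ; index = MaxLeaf.offset
  ; graft-insert = OnLeaf.graft-leaf
  ; index-insert = λ m t i i<t below _ → OnLeaf.offset-graft m t i i<t below
  ; avoids-insert = λ m t i _ → OnLeaf.avoids-graft m t i
  ; reinsertion = OnLeaf.reinsert
  }

scheme132 : InsertionScheme at132
scheme132 = record
  { insert = OnMaximal.graftOnMaximal
  ; index = MaxLeaf.offset
  ; graft-insert = OnMaximal.graft-maximal
  ; index-insert = λ m t i i<t below _ → OnMaximal.offset-graft m t i i<t below
  ; avoids-insert = OnMaximal.avoids-graft
  ; reinsertion = OnMaximal.reinsert
  }

scheme1-23 : InsertionScheme at1-23
scheme1-23 = record
  { insert = Spine.graftOnSpine
  ; index = Spine.spineDepth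
  ; graft-insert = Spine.graft-spine
  ; index-insert = Spine.spineDepth-graft
  ; avoids-insert = λ m t i _ _ → Spine.avoids-graft m t i
  ; reinsertion = Spine.reinsert
  }

module Count123 = Counting occurs-123 scheme123
module Count132 = Counting occurs-132 scheme132
module Count1-23 = Counting occurs-1-23 scheme1-23

↔-empty : ∀ {A B : Set} → ¬ A → ¬ B → A ↔ B
↔-empty ¬a ¬b = mk↔ₛ′ (⊥-elim ∘ ¬a) (⊥-elim ∘ ¬b) (⊥-elim ∘ ¬b) (⊥-elim ∘ ¬a)

same-count : ∀ {P Q} → ¬ Avoiders P 0 → ¬ Avoiders Q 0 →
  (∀ n → Avoiders P (suc n) ↔ Fin (n !)) → (∀ n → Avoiders Q (suc n) ↔ Fin (n !)) →
  ∀ l → Avoiders P l ↔ Avoiders Q l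
same-count ¬P₀ ¬Q₀ P↔ Q↔ zero = ↔-empty ¬P₀ ¬Q₀
same-count ¬P₀ ¬Q₀ P↔ Q↔ (suc n) = ↔-trans (P↔ n) (↔-sym (Q↔ n))

mainTheorem7 : ((l : ℕ) → Avoiders p132 l ↔ Avoiders p123 l)
    × ((l : ℕ) → Avoiders p123 l ↔ Avoiders p1-23 l)
    × ((n : ℕ) → 3 ≤ n →
        (Fin ((n ∸ 1) !) ↔ Avoiders p132 n)
        × (Fin ((n ∸ 1) !) ↔ Avoiders p123 n)
        × (Fin ((n ∸ 1) !) ↔ Avoiders p1-23 n))
mainTheorem7 =
    same-count Count132.no-Avoiders-0 Count123.no-Avoiders-0 Count132.Avoiders↔Fin! Count123.Avoiders↔Fin!
  , same-count Count123.no-Avoiders-0 Count1-23.no-Avoiders-0 Count123.Avoiders↔Fin! Count1-23.Avoiders↔Fin!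
  , λ { (suc n) _ → ↔-sym (Count132.Avoiders↔Fin! n)
                  , ↔-sym (Count123.Avoiders↔Fin! n)
                  , ↔-sym (Count1-23.Avoiders↔Fin! n) }
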